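{- Let $I=(a_1,\dots,a_n)\in(0,1]^n$ be a sorted item sequence such that the assignment $f$ produced by $MM_2$ for $I$ has at least one bin containing a sole class-1 item. Let $p$ be the maximum index of such a sole class-1 item in $f$, and let $U$ be the set of indices of items (other than $1,\dots,p$) that are packed in $f$ in the same bin as one of the items $1,2,\dots,p$ (possibly $U=\emptyset$). Then for an arbitrary assignment $g$ for $I$ without cardinality constraints, letting $W$ be the set of indices of items packed in $g$ in the same bin as one of the items $1,2,\dots,p$, we have $W\subseteq U$.
   Context: An item sequence $I=(a_1,\dots,a_n)\in(0,1]^n$ is sorted if $a_1\ge\cdots\ge a_n$; items are referred to by their index in this order (the sorting step of $MM_2$ leaves a sorted sequence unchanged). An assignment without cardinality constraints is a map $f:\{1,\dots,n\}\to\mathbb{N}$ with $\sum_{i:f(i)=j}a_i\le1$ for every bin $j$. An item is a sole item if its bin contains no other item. A class-1 item is an item of size in $(\frac12,1]$. Algorithm $MM_k$ (here $k=2$): sort the input non-increasingly, with head pointer $h=1$, tail pointer $t=n$, and one current open bin. Repeat: if the current bin already contains $k$ items, close it and open a new empty bin; else if the head item $a_h$ fits (current load plus $a_h\le1$), pack it and advance $h$; else if the tail item $a_t$ fits, pack it and decrease $t$; else close the current bin and open a new empty bin. Stop when all items are packed.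
   Formalization: The item sizes of the sequence $I$ are rational numbers in (0,1]. -}

module Defs where

open import Data.Nat as ℕ using (ℕ; zero; suc)
open import Data.Fin as Fin using (Fin)
open import Data.Fin.Properties using () renaming (_≟_ to _≟ᶠ_)
open import Data.Rational as ℚ using (ℚ; 0ℚ; 1ℚ; ½)
open import Data.Rational.Properties using () renaming (_≤?_ to _≤ℚ?_)
open import Data.List using (List; []; _∷_; allFin; unsnoc; foldr; map)
open import Data.Maybe using (just; nothing)
open import Data.Product using (_×_; _,_; ∃)
open import Relation.Nullary using (yes; no; ¬_)
open import Relation.Binary.PropositionalEquality using (_≡_)

-- An item sequence of length n: item i (0-based index, i.e. item a_{i+1})
-- has size a i.
Items : ℕ → Set
Items n = Fin n → ℚ

InUnitInterval : ∀ {n} → Items n → Set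
InUnitInterval a = ∀ i → (0ℚ ℚ.< a i) × (a i ℚ.≤ 1ℚ)

Sorted : ∀ {n} → Items n → Set
Sorted a = ∀ i j → i Fin.≤ j → a j ℚ.≤ a i

load : ∀ {n} → Items n → (Fin n → ℕ) → ℕ → ℚ
load {n} a g b = foldr ℚ._+_ 0ℚ (map (λ i → if-bin (g i ℕ.≟ b) i) (allFin n))
  where
  if-bin : ∀ {x y : ℕ} → Relation.Nullary.Dec (x ≡ y) → Fin n → ℚ
  if-bin (yes _) i = a i
  if-bin (no _)  i = 0ℚ

IsAssignment : ∀ {n} → Items n → (Fin n → ℕ) → Set
IsAssignment a g = ∀ b → load a g b ℚ.≤ 1ℚ

Sole : ∀ {n} → (Fin n → ℕ) → Fin n → Set
Sole f i = ∀ j → f j ≡ f i → j ≡ i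

Class1 : ∀ {n} → Items n → Fin n → Set
Class1 a i = (½ ℚ.< a i) × (a i ℚ.≤ 1ℚ)

-- Algorithm MM_k (input assumed already sorted, so the sorting step is
-- the identity).  The remaining items form a list of indices in sorted
-- order: its first element is the head item a_h, its last element the
-- tail item a_t.  State: current bin number, number of items in it,
-- its load, and the assignment built so far.  'fuel' bounds the number
-- of loop iterations; 3n+1 iterations always suffice (each iteration
-- either packs an item or closes a nonempty bin).

update : ∀ {n} → (Fin n → ℕ) → Fin n → ℕ → (Fin n → ℕ)
update acc i b j with j ≟ᶠ i
... | yes _ = b
... | no  _ = acc j

MMloop : ∀ {n} → ℕ → Items n → ℕ → List (Fin n) → ℕ → ℕ → ℚ
       → (Fin n → ℕ) → (Fin n → ℕ)
MMloop zero a k rem bin cnt L acc = acc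
MMloop (suc fuel) a k [] bin cnt L acc = acc
MMloop (suc fuel) a k (x ∷ xs) bin cnt L acc with cnt ℕ.≟ k
... | yes _ = MMloop fuel a k (x ∷ xs) (suc bin) 0 0ℚ acc
... | no _ with (L ℚ.+ a x) ≤ℚ? 1ℚ
...   | yes _ = MMloop fuel a k xs bin (suc cnt) (L ℚ.+ a x) (update acc x bin)
...   | no _ with unsnoc (x ∷ xs)
...     | nothing = acc
...     | just (ys , y) with (L ℚ.+ a y) ≤ℚ? 1ℚ
...       | yes _ = MMloop fuel a k ys bin (suc cnt) (L ℚ.+ a y) (update acc y bin)
...       | no _  = MMloop fuel a k (x ∷ xs) (suc bin) 0 0ℚ acc

-- the assignment produced by MM_k on a (sorted) item sequence;
-- bins are numbered 0,1,2,... in the order they are opened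
MM : ℕ → ∀ {n} → Items n → (Fin n → ℕ)
MM k {n} a = MMloop (3 ℕ.* n ℕ.+ 1) a k (allFin n) 0 0 0ℚ (λ _ → 0)

MM₂ : ∀ {n} → Items n → (Fin n → ℕ)
MM₂ = MM 2

IsMaxSoleClass1 : ∀ {n} → Items n → (Fin n → ℕ) → Fin n → Set
IsMaxSoleClass1 a f p =
  (Sole f p × Class1 a p) × (∀ q → Sole f q → Class1 a q → q Fin.≤ p)

InU : ∀ {n} → (Fin n → ℕ) → Fin n → Fin n → Set
InU f p u = (p Fin.< u) × ∃ λ i → (i Fin.≤ p) × (f u ≡ f i)

InW : ∀ {n} → (Fin n → ℕ) → Fin n → Fin n → Set
InW g p w = ∃ λ i → (i Fin.≤ p) × ¬ (w ≡ i) × (g w ≡ g i)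

{-# OPTIONS --safe #-}

-- Items 1..p are class 1, so an assignment g never puts two of them together; an item
-- w sharing a bin with some i ≤ p in g is therefore a "partner" of p: w > p and
-- a_p + a_w ≤ 1.  It remains to see that MM_k (k ≥ 2) packs every partner of a sole
-- class-1 item p with an item ≤ p.  While p is unpacked, every bin is opened by a head
-- item i ≤ p, no further head item fits beside it, so a partner packed in this phase
-- comes from the tail and joins i.  When p itself opens a bin, neither the head nor the
-- tail item may join it since p is sole; as the tail item is the smallest one left, no
-- partner is left either.
module Submission where

open import Defs
open import Data.Nat using (ℕ)
open import Data.Fin using (Fin)

open import Data.Empty using (⊥; ⊥-elim)
open import Data.Fin as Fin using (zero)
import Data.Fin.Properties as Finₚ
open import Data.List using (List; []; _∷_; _∷ʳ_; allFin; foldr; map; unsnoc; initLast; _∷ʳ′_)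
open import Data.List.Membership.Propositional using (_∈_; _∉_)
open import Data.List.Membership.Propositional.Properties using (∈-allFin; ∈-++⁻; ∈-++⁺ˡ; ∈-++⁺ʳ)
open import Data.List.Relation.Binary.Subset.Propositional using (_⊆_)
open import Data.List.Relation.Unary.All as All using (All; []; _∷_)
import Data.List.Relation.Unary.All.Properties as Allₚ
open import Data.List.Relation.Unary.AllPairs using (AllPairs; []; _∷_)
import Data.List.Relation.Unary.AllPairs.Properties as AllPairsₚ
open import Data.List.Relation.Unary.Any using (here; there)
open import Data.Maybe using (just; nothing)
open import Data.Nat as ℕ using (suc; _*_)
import Data.Nat.Properties as ℕₚ
open import Data.Product using (_×_; _,_; ∃; proj₁; proj₂)
open import Data.Rational as ℚ using (ℚ; 0ℚ; 1ℚ; ½)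
import Data.Rational.Properties as ℚₚ
open import Data.Sum using (inj₁; inj₂)
open import Relation.Nullary using (yes; no; ¬_)
open import Relation.Binary.PropositionalEquality

0≤q⇒p≤p+q : ∀ {p q} → 0ℚ ℚ.≤ q → p ℚ.≤ p ℚ.+ q
0≤q⇒p≤p+q {p} 0≤q = subst (ℚ._≤ p ℚ.+ _) (ℚₚ.+-identityʳ p) (ℚₚ.+-monoʳ-≤ p 0≤q)

0≤q⇒p≤q+p : ∀ {p q} → 0ℚ ℚ.≤ q → p ℚ.≤ q ℚ.+ p
0≤q⇒p≤q+p {p} {q} 0≤q = subst (p ℚ.≤_) (ℚₚ.+-comm p q) (0≤q⇒p≤p+q 0≤q)

p≡0⇒p+q≡q : ∀ {p} q → p ≡ 0ℚ → p ℚ.+ q ≡ q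
p≡0⇒p+q≡q q refl = ℚₚ.+-identityˡ q

½<p⇒½<q⇒p+q≰1 : ∀ {p q} → ½ ℚ.< p → ½ ℚ.< q → ¬ (p ℚ.+ q ℚ.≤ 1ℚ)
½<p⇒½<q⇒p+q≰1 ½<p ½<q p+q≤1 = ℚₚ.<-irrefl refl (ℚₚ.<-≤-trans (ℚₚ.+-mono-< ½<p ½<q) p+q≤1)

sumℚ : ∀ {A : Set} → (A → ℚ) → List A → ℚ
sumℚ F xs = foldr ℚ._+_ 0ℚ (map F xs)

module _ {A : Set} {F : A → ℚ} (F≥0 : ∀ x → 0ℚ ℚ.≤ F x) where

  sumℚ-nonneg : ∀ xs → 0ℚ ℚ.≤ sumℚ F xs
  sumℚ-nonneg []       = ℚₚ.≤-refl
  sumℚ-nonneg (x ∷ xs) = ℚₚ.≤-trans (sumℚ-nonneg xs) (0≤q⇒p≤q+p (F≥0 x))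

  sumℚ-∈ : ∀ {x xs} → x ∈ xs → F x ℚ.≤ sumℚ F xs
  sumℚ-∈ {xs = _ ∷ xs} (here refl) = 0≤q⇒p≤p+q (sumℚ-nonneg xs)
  sumℚ-∈ {xs = y ∷ _}  (there x∈)  = ℚₚ.≤-trans (sumℚ-∈ x∈) (0≤q⇒p≤q+p (F≥0 y))

  sumℚ-∈₂ : ∀ {x y xs} → x ∈ xs → y ∈ xs → x ≢ y → F x ℚ.+ F y ℚ.≤ sumℚ F xs
  sumℚ-∈₂ (here refl) (here refl) x≢y = ⊥-elim (x≢y refl)
  sumℚ-∈₂ {x} (here refl) (there y∈) _ = ℚₚ.+-monoʳ-≤ (F x) (sumℚ-∈ y∈)
  sumℚ-∈₂ {x} {y} (there x∈) (here refl) _ =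
    subst (ℚ._≤ F y ℚ.+ _) (ℚₚ.+-comm (F y) (F x)) (ℚₚ.+-monoʳ-≤ (F y) (sumℚ-∈ x∈))
  sumℚ-∈₂ {xs = z ∷ _} (there x∈) (there y∈) x≢y =
    ℚₚ.≤-trans (sumℚ-∈₂ x∈ y∈ x≢y) (0≤q⇒p≤q+p (F≥0 z))

-- The summand of load is local to its definition; unifying load a g b with
-- sumℚ F (allFin n) recovers it.
summand : ∀ {n} {F : Fin n → ℚ} (s : ℚ) → s ≡ sumℚ F (allFin n) → Fin n → ℚ
summand {F = F} _ _ = F

sizeInBin : ∀ {n} → Items n → (Fin n → ℕ) → ℕ → Fin n → ℚ
sizeInBin a g b = summand (load a g b) refl

module _ {n} (a : Items n) (g : Fin n → ℕ) (b : ℕ) where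

  sizeInBin-≡ : ∀ {j} → g j ≡ b → sizeInBin a g b j ≡ a j
  sizeInBin-≡ {j} gj≡b with g j ℕ.≟ b
  ... | yes _    = refl
  ... | no gj≢b = ⊥-elim (gj≢b gj≡b)

  sizeInBin-nonneg : (∀ j → 0ℚ ℚ.≤ a j) → ∀ j → 0ℚ ℚ.≤ sizeInBin a g b j
  sizeInBin-nonneg a≥0 j with g j ℕ.≟ b
  ... | yes _ = a≥0 j
  ... | no _  = ℚₚ.≤-refl

  load-≥-pair : (∀ j → 0ℚ ℚ.≤ a j) → ∀ {i j} → i ≢ j → g i ≡ b → g j ≡ b
              → a i ℚ.+ a j ℚ.≤ load a g b
  load-≥-pair a≥0 {i} {j} i≢j gi≡b gj≡b =
    subst₂ (λ x y → x ℚ.+ y ℚ.≤ load a g b) (sizeInBin-≡ gi≡b) (sizeInBin-≡ gj≡b)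
      (sumℚ-∈₂ (sizeInBin-nonneg a≥0) (∈-allFin i) (∈-allFin j) i≢j)

∉∧∈⇒≢ : ∀ {A : Set} {x y : A} {xs} → x ∉ xs → y ∈ xs → x ≢ y
∉∧∈⇒≢ x∉ y∈ refl = x∉ y∈

∉-∷ʳ⁻ : ∀ {A : Set} {x y : A} {ys} → x ∉ ys ∷ʳ y → x ∉ ys × x ≢ y
∉-∷ʳ⁻ {ys = ys} x∉ = (λ x∈ → x∉ (∈-++⁺ˡ x∈)) , ∉∧∈⇒≢ x∉ (∈-++⁺ʳ ys (here refl))

unsnoc≡just⇒∷ʳ : ∀ {A : Set} {xs ys : List A} {y} → unsnoc xs ≡ just (ys , y) → xs ≡ ys ∷ʳ y
unsnoc≡just⇒∷ʳ {xs = xs} eq with initLast xs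
unsnoc≡just⇒∷ʳ refl | _ ∷ʳ′ _ = refl

AllPairs-∷ʳ⁻ : ∀ {A : Set} {R : A → A → Set} {xs y} → AllPairs R (xs ∷ʳ y)
             → AllPairs R xs × All (λ x → R x y) xs
AllPairs-∷ʳ⁻ {xs = []}    _          = [] , []
AllPairs-∷ʳ⁻ {xs = _ ∷ _} (px ∷ pxs) with AllPairs-∷ʳ⁻ pxs | Allₚ.∷ʳ⁻ px
... | pxs′ , pxs-y | px′ , px-y = (px′ ∷ pxs′) , (px-y ∷ pxs-y)

module _ {n : ℕ} where

  Increasing : List (Fin n) → Set
  Increasing = AllPairs Fin._<_

  record Removal (rem : List (Fin n)) (z : Fin n) (rem′ : List (Fin n)) : Set where
    field
      removed-∈   : z ∈ rem
      removed-∉   : z ∉ rem′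
      ⊆-original  : rem′ ⊆ rem
      kept        : ∀ {j} → j ∈ rem → j ≢ z → j ∈ rem′
      increasing′ : Increasing rem′

  head-< : ∀ {x xs j} → Increasing (x ∷ xs) → j ∈ xs → x Fin.< j
  head-< (x<xs ∷ _) j∈ = All.lookup x<xs j∈

  head-≤ : ∀ {x xs j} → Increasing (x ∷ xs) → j ∈ x ∷ xs → x Fin.≤ j
  head-≤ _   (here refl) = Finₚ.≤-refl
  head-≤ inc (there j∈)  = ℕₚ.<⇒≤ (head-< inc j∈)

  removal-head : ∀ {x xs} → Increasing (x ∷ xs) → Removal (x ∷ xs) x xs
  removal-head {x} {xs} inc@(_ ∷ xs↑) = record
    { removed-∈   = here refl
    ; removed-∉   = λ x∈ → ℕₚ.<-irrefl refl (head-< inc x∈)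
    ; ⊆-original  = there
    ; kept        = kept
    ; increasing′ = xs↑
    }
    where
    kept : ∀ {j} → j ∈ x ∷ xs → j ≢ x → j ∈ xs
    kept (here refl) j≢x = ⊥-elim (j≢x refl)
    kept (there j∈)  _   = j∈

  last-≥ : ∀ {rem ys y j} → rem ≡ ys ∷ʳ y → Increasing rem → j ∈ rem → j Fin.≤ y
  last-≥ {ys = ys} refl inc j∈ with ∈-++⁻ ys j∈
  ... | inj₁ j∈ys       = ℕₚ.<⇒≤ (All.lookup (proj₂ (AllPairs-∷ʳ⁻ inc)) j∈ys)
  ... | inj₂ (here refl) = Finₚ.≤-refl

  removal-last : ∀ {rem ys y} → rem ≡ ys ∷ʳ y → Increasing rem → Removal rem y ys
  removal-last {ys = ys} {y} refl inc = record
    { removed-∈   = ∈-++⁺ʳ ys (here refl)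
    ; removed-∉   = λ y∈ → ℕₚ.<-irrefl refl (All.lookup ys<y y∈)
    ; ⊆-original  = ∈-++⁺ˡ
    ; kept        = kept
    ; increasing′ = ys↑
    }
    where
    ys↑  = proj₁ (AllPairs-∷ʳ⁻ inc)
    ys<y = proj₂ (AllPairs-∷ʳ⁻ inc)
    kept : ∀ {j} → j ∈ ys ∷ʳ y → j ≢ y → j ∈ ys
    kept j∈ j≢y with ∈-++⁻ ys j∈
    ... | inj₁ j∈ys       = j∈ys
    ... | inj₂ (here refl) = ⊥-elim (j≢y refl)

module _ {n} (acc : Fin n → ℕ) (z : Fin n) (b : ℕ) where

  update-≡ : update acc z b z ≡ b
  update-≡ with z Finₚ.≟ z
  ... | yes _   = refl
  ... | no z≢z = ⊥-elim (z≢z refl)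

  update-≢ : ∀ {j} → j ≢ z → update acc z b j ≡ acc j
  update-≢ {j} j≢z with j Finₚ.≟ z
  ... | yes j≡z = ⊥-elim (j≢z j≡z)
  ... | no _    = refl

MMloop-keeps-packed : ∀ {n} fuel (a : Items n) k rem bin cnt L acc {j} → j ∉ rem
              → MMloop fuel a k rem bin cnt L acc j ≡ acc j
MMloop-keeps-packed ℕ.zero     a k rem      bin cnt L acc j∉ = refl
MMloop-keeps-packed (suc fuel) a k []       bin cnt L acc j∉ = refl
MMloop-keeps-packed (suc fuel) a k (x ∷ xs) bin cnt L acc j∉ with cnt ℕ.≟ k
... | yes _ = MMloop-keeps-packed fuel a k (x ∷ xs) (suc bin) 0 0ℚ acc j∉
... | no _ with (L ℚ.+ a x) ℚₚ.≤? 1ℚ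
...   | yes _ = trans (MMloop-keeps-packed fuel a k xs bin (suc cnt) _ _ (λ j∈ → j∉ (there j∈)))
                      (update-≢ acc x bin (∉∧∈⇒≢ j∉ (here refl)))
...   | no _ with unsnoc (x ∷ xs) in eq
...     | nothing = refl
...     | just (ys , y) with (L ℚ.+ a y) ℚₚ.≤? 1ℚ
...       | no _  = MMloop-keeps-packed fuel a k (x ∷ xs) (suc bin) 0 0ℚ acc j∉
...       | yes _ with ∉-∷ʳ⁻ (subst (_ ∉_) (unsnoc≡just⇒∷ʳ eq) j∉)
...         | j∉ys , j≢y =
              trans (MMloop-keeps-packed fuel a k ys bin (suc cnt) _ _ j∉ys)
                    (update-≢ acc y bin j≢y)

SoleAmongPacked : ∀ {n} → List (Fin n) → (Fin n → ℕ) → Fin n → Set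
SoleAmongPacked rem acc p = p ∉ rem → ∀ {j} → j ∉ rem → acc j ≡ acc p → j ≡ p

sole⇒soleAmongPacked : ∀ {n} fuel (a : Items n) k rem bin cnt L acc {p}
            → Sole (MMloop fuel a k rem bin cnt L acc) p → SoleAmongPacked rem acc p
sole⇒soleAmongPacked fuel a k rem bin cnt L acc sole p∉ j∉ accj≡accp =
  sole _ (trans (MMloop-keeps-packed fuel a k rem bin cnt L acc j∉)
         (trans accj≡accp (sym (MMloop-keeps-packed fuel a k rem bin cnt L acc p∉))))

open Removal

module Partners {n} (a : Items (suc n)) (sizes : InUnitInterval a) (sorted : Sorted a)
                (k : ℕ) (p : Fin (suc n)) (p-class1 : Class1 a p) where

  open import Data.List.Membership.DecPropositional (Finₚ._≟_ {suc n}) using (_∈?_)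

  private
    Index = Fin (suc n)

  Partner : Index → Set
  Partner w = p Fin.< w × a p ℚ.+ a w ℚ.≤ 1ℚ

  PartnersPaired : (Index → ℕ) → Set
  PartnersPaired f = ∀ w → Partner w → ∃ λ i → i Fin.≤ p × f w ≡ f i

  size-nonneg : ∀ j → 0ℚ ℚ.≤ a j
  size-nonneg j = ℚₚ.<⇒≤ (proj₁ (sizes j))

  fits-empty : ∀ {L} j → L ≡ 0ℚ → L ℚ.+ a j ℚ.≤ 1ℚ
  fits-empty j L≡0 = subst (ℚ._≤ 1ℚ) (sym (p≡0⇒p+q≡q (a j) L≡0)) (proj₂ (sizes j))

  ≤p⇒½<size : ∀ {i} → i Fin.≤ p → ½ ℚ.< a i
  ≤p⇒½<size {i} i≤p = ℚₚ.<-≤-trans (proj₁ p-class1) (sorted i p i≤p)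

  ≤p⇒≤p⇒overflow : ∀ {i j} → i Fin.≤ p → j Fin.≤ p → ¬ (a i ℚ.+ a j ℚ.≤ 1ℚ)
  ≤p⇒≤p⇒overflow i≤p j≤p = ½<p⇒½<q⇒p+q≰1 (≤p⇒½<size i≤p) (≤p⇒½<size j≤p)

  co-packed⇒partner : ∀ {g} → IsAssignment a g → ∀ {i w} → i Fin.≤ p → w ≢ i → g w ≡ g i
                    → Partner w
  co-packed⇒partner {g} g-fits {i} {w} i≤p w≢i gw≡gi = p<w , ap+aw≤1
    where
    ai+aw≤1 : a i ℚ.+ a w ℚ.≤ 1ℚ
    ai+aw≤1 = ℚₚ.≤-trans (load-≥-pair a g (g i) size-nonneg (≢-sym w≢i) refl gw≡gi) (g-fits (g i))
    p<w : p Fin.< w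
    p<w = ℕₚ.≰⇒> (λ w≤p → ≤p⇒≤p⇒overflow i≤p w≤p ai+aw≤1)
    ap+aw≤1 : a p ℚ.+ a w ℚ.≤ 1ℚ
    ap+aw≤1 = ℚₚ.≤-trans (ℚₚ.+-monoˡ-≤ (a w) (sorted i p i≤p)) ai+aw≤1

  data Phase (rem : List Index) (bin cnt : ℕ) (L : ℚ) (acc : Index → ℕ) : Set where
    empty-bin        : p ∈ rem → cnt ≡ 0 → L ≡ 0ℚ → Phase rem bin cnt L acc
    bin-holds-≤p     : p ∈ rem → ∀ i → i Fin.≤ p → i ∉ rem → acc i ≡ bin → a i ℚ.≤ L
                     → Phase rem bin cnt L acc
    bin-holds-only-p : p ∉ rem → acc p ≡ bin → cnt ≡ 1 → L ≡ a p → Phase rem bin cnt L acc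
    partners-packed  : (∀ w → Partner w → w ∉ rem) → Phase rem bin cnt L acc

  record Invariant (rem : List Index) (bin cnt : ℕ) (L : ℚ) (acc : Index → ℕ) : Set where
    field
      increasing      : Increasing rem
      -- If the loop runs out of fuel, the unpacked items stay in bin 0, which is also
      -- the bin of item zero ≤ p.
      unpacked-in-0   : ∀ {j} → j ∈ rem → acc j ≡ 0
      zero-in-0       : acc zero ≡ 0
      zero-first      : zero ∈ rem → bin ≡ 0 × cnt ≡ 0 × L ≡ 0ℚ
      packed-partners : ∀ w → Partner w → w ∉ rem → ∃ λ i → i Fin.≤ p × i ∉ rem × acc w ≡ acc i
      phase           : Phase rem bin cnt L acc

  open Invariant

  invariant⇒paired : ∀ {rem bin cnt L acc} → Invariant rem bin cnt L acc → PartnersPaired acc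
  invariant⇒paired {rem} inv w w-partner with w ∈? rem
  ... | yes w∈ = zero , ℕ.z≤n , trans (unpacked-in-0 inv w∈) (sym (zero-in-0 inv))
  ... | no w∉ with packed-partners inv w w-partner w∉
  ...   | i , i≤p , _ , accw≡acci = i , i≤p , accw≡acci

  close : ∀ {rem bin cnt L acc} → Invariant rem bin cnt L acc → zero ∉ rem
        → Phase rem (suc bin) 0 0ℚ acc → Invariant rem (suc bin) 0 0ℚ acc
  close inv zero∉ phase′ = record
    { increasing      = increasing inv
    ; unpacked-in-0   = unpacked-in-0 inv
    ; zero-in-0       = zero-in-0 inv
    ; zero-first      = λ zero∈ → ⊥-elim (zero∉ zero∈)
    ; packed-partners = packed-partners inv
    ; phase           = phase′
    }

  pack : ∀ {rem z rem′ bin cnt L L′ acc} → Invariant rem bin cnt L acc → Removal rem z rem′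
       → zero ∉ rem′
       → (Partner z → ∃ λ i → i Fin.≤ p × i ∉ rem × acc i ≡ bin)
       → Phase rem′ bin (suc cnt) L′ (update acc z bin)
       → Invariant rem′ bin (suc cnt) L′ (update acc z bin)
  pack {rem} {z} {rem′} {bin} {acc = acc} inv R zero∉ z-joins phase′ = record
    { increasing      = increasing′ R
    ; unpacked-in-0   = λ j∈ → trans (update-≢ acc z bin (≢-sym (∉∧∈⇒≢ (removed-∉ R) j∈)))
                                     (unpacked-in-0 inv (⊆-original R j∈))
    ; zero-in-0       = zero-in-0′
    ; zero-first      = λ zero∈ → ⊥-elim (zero∉ zero∈)
    ; packed-partners = packed-partners′
    ; phase           = phase′
    }
    where
    acc′ = update acc z bin

    unmoved : ∀ {i} → i ∉ rem → acc′ i ≡ acc i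
    unmoved i∉ = update-≢ acc z bin (∉∧∈⇒≢ i∉ (removed-∈ R))

    still-packed : ∀ {i} → i ∉ rem → i ∉ rem′
    still-packed i∉ i∈ = i∉ (⊆-original R i∈)

    zero-in-0′ : acc′ zero ≡ 0
    zero-in-0′ with zero Finₚ.≟ z
    ... | yes refl = proj₁ (zero-first inv (removed-∈ R))
    ... | no _     = zero-in-0 inv

    packed-partners′ : ∀ w → Partner w → w ∉ rem′ → ∃ λ i → i Fin.≤ p × i ∉ rem′ × acc′ w ≡ acc′ i
    packed-partners′ w w-partner w∉ with w Finₚ.≟ z
    packed-partners′ w w-partner w∉ | no w≢z
      with packed-partners inv w w-partner (λ w∈ → w∉ (kept R w∈ w≢z))
    ... | i , i≤p , i∉ , accw≡acci = i , i≤p , still-packed i∉ , trans accw≡acci (sym (unmoved i∉))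
    packed-partners′ w w-partner w∉ | yes refl with z-joins w-partner
    ... | i , i≤p , i∉ , acci≡bin = i , i≤p , still-packed i∉ , sym (trans (unmoved i∉) acci≡bin)

  cannot-join-p : ∀ {rem z rem′ bin acc} → Removal rem z rem′
                → SoleAmongPacked rem′ (update acc z bin) p → p ∉ rem → acc p ≡ bin → ⊥
  cannot-join-p {rem} {z} {bin = bin} {acc} R sole p∉ accp≡bin =
    p∉ (subst (_∈ rem) (sole (λ p∈ → p∉ (⊆-original R p∈)) (removed-∉ R) z-beside-p) (removed-∈ R))
    where
    z-beside-p : update acc z bin z ≡ update acc z bin p
    z-beside-p = trans (update-≡ acc z bin)
                       (sym (trans (update-≢ acc z bin (∉∧∈⇒≢ p∉ (removed-∈ R))) accp≡bin))

  pack-head : ∀ {x xs bin cnt L acc} → Invariant (x ∷ xs) bin cnt L acc → L ℚ.+ a x ℚ.≤ 1ℚ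
            → SoleAmongPacked xs (update acc x bin) p
            → Invariant xs bin (suc cnt) (L ℚ.+ a x) (update acc x bin)
  pack-head {x} {xs} {bin} {cnt} {L} {acc} inv fits sole =
    pack inv R zero∉ (λ x-partner → ⊥-elim (head-not-partner x-partner)) phase′
    where
    R = removal-head (increasing inv)

    zero∉ : zero ∉ xs
    zero∉ zero∈ = ℕₚ.n≮0 (head-< (increasing inv) zero∈)

    x≤p : p ∈ x ∷ xs → x Fin.≤ p
    x≤p = head-≤ (increasing inv)

    head-not-partner : ¬ Partner x
    head-not-partner x-partner@(p<x , _) with phase inv
    ... | empty-bin p∈ _ _               = ℕₚ.<⇒≱ p<x (x≤p p∈)
    ... | bin-holds-≤p p∈ _ _ _ _ _      = ℕₚ.<⇒≱ p<x (x≤p p∈)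
    ... | bin-holds-only-p p∉ accp≡bin _ _ = cannot-join-p R sole p∉ accp≡bin
    ... | partners-packed done           = done x x-partner (here refl)

    phase′ : Phase xs bin (suc cnt) (L ℚ.+ a x) (update acc x bin)
    phase′ with phase inv
    ... | bin-holds-≤p p∈ i i≤p _ _ ai≤L =
          ⊥-elim (≤p⇒≤p⇒overflow i≤p (x≤p p∈) (ℚₚ.≤-trans (ℚₚ.+-monoˡ-≤ (a x) ai≤L) fits))
    ... | bin-holds-only-p p∉ accp≡bin _ _ = ⊥-elim (cannot-join-p R sole p∉ accp≡bin)
    ... | partners-packed done = partners-packed (λ w w-partner w∈ → done w w-partner (there w∈))
    ... | empty-bin p∈ cnt≡0 L≡0 with x Finₚ.≟ p
    ...   | yes refl = bin-holds-only-p (removed-∉ R) (update-≡ acc x bin) (cong suc cnt≡0)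
                                        (p≡0⇒p+q≡q (a x) L≡0)
    ...   | no x≢p  = bin-holds-≤p (kept R p∈ (≢-sym x≢p)) x (x≤p p∈) (removed-∉ R)
                                   (update-≡ acc x bin) (ℚₚ.≤-reflexive (sym (p≡0⇒p+q≡q (a x) L≡0)))

  pack-tail : ∀ {rem ys x y bin cnt L acc} → Invariant rem bin cnt L acc
            → ¬ (L ℚ.+ a x ℚ.≤ 1ℚ) → L ℚ.+ a y ℚ.≤ 1ℚ → Removal rem y ys
            → SoleAmongPacked ys (update acc y bin) p
            → Invariant ys bin (suc cnt) (L ℚ.+ a y) (update acc y bin)
  pack-tail {rem} {ys} {x} {y} {bin} {cnt} {L} {acc} inv x-overflows fits R sole =
    pack inv R zero∉ y-joins phase′
    where
    L≢0 : L ≢ 0ℚ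
    L≢0 L≡0 = x-overflows (fits-empty x L≡0)

    zero∉ : zero ∉ ys
    zero∉ zero∈ = L≢0 (proj₂ (proj₂ (zero-first inv (⊆-original R zero∈))))

    y-joins : Partner y → ∃ λ i → i Fin.≤ p × i ∉ rem × acc i ≡ bin
    y-joins y-partner with phase inv
    ... | empty-bin _ _ L≡0                  = ⊥-elim (L≢0 L≡0)
    ... | bin-holds-≤p _ i i≤p i∉ acci≡bin _ = i , i≤p , i∉ , acci≡bin
    ... | bin-holds-only-p p∉ accp≡bin _ _   = ⊥-elim (cannot-join-p R sole p∉ accp≡bin)
    ... | partners-packed done               = ⊥-elim (done y y-partner (removed-∈ R))

    phase′ : Phase ys bin (suc cnt) (L ℚ.+ a y) (update acc y bin)
    phase′ with phase inv
    ... | empty-bin _ _ L≡0 = ⊥-elim (L≢0 L≡0)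
    ... | bin-holds-only-p p∉ accp≡bin _ _ = ⊥-elim (cannot-join-p R sole p∉ accp≡bin)
    ... | partners-packed done =
          partners-packed (λ w w-partner w∈ → done w w-partner (⊆-original R w∈))
    ... | bin-holds-≤p p∈ i i≤p i∉ acci≡bin ai≤L =
          bin-holds-≤p (kept R p∈ p≢y) i i≤p (λ i∈ → i∉ (⊆-original R i∈))
            (trans (update-≢ acc y bin (∉∧∈⇒≢ i∉ (removed-∈ R))) acci≡bin)
            (ℚₚ.≤-trans ai≤L (0≤q⇒p≤p+q (size-nonneg y)))
      where
      p≢y : p ≢ y
      p≢y refl = ≤p⇒≤p⇒overflow i≤p Finₚ.≤-refl (ℚₚ.≤-trans (ℚₚ.+-monoˡ-≤ (a p) ai≤L) fits)

  close-full : ∀ {rem bin L acc} → Invariant rem bin (2 ℕ.+ k) L acc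
             → Invariant rem (suc bin) 0 0ℚ acc
  close-full {rem} {bin} {acc = acc} inv = close inv zero∉ phase′
    where
    zero∉ : zero ∉ rem
    zero∉ zero∈ with zero-first inv zero∈
    ... | _ , () , _

    phase′ : Phase rem (suc bin) 0 0ℚ acc
    phase′ with phase inv
    ... | empty-bin _ () _
    ... | bin-holds-≤p p∈ _ _ _ _ _ = empty-bin p∈ refl refl
    ... | bin-holds-only-p _ _ () _
    ... | partners-packed done = partners-packed done

  close-stuck : ∀ {rem bin cnt L acc y} → Invariant rem bin cnt L acc
              → (∀ {j} → j ∈ rem → j Fin.≤ y) → ¬ (L ℚ.+ a y ℚ.≤ 1ℚ)
              → Invariant rem (suc bin) 0 0ℚ acc
  close-stuck {rem} {bin} {acc = acc} {y} inv ≤y y-overflows = close inv zero∉ phase′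
    where
    zero∉ : zero ∉ rem
    zero∉ zero∈ = y-overflows (fits-empty y (proj₂ (proj₂ (zero-first inv zero∈))))

    phase′ : Phase rem (suc bin) 0 0ℚ acc
    phase′ with phase inv
    ... | empty-bin p∈ _ _ = empty-bin p∈ refl refl
    ... | bin-holds-≤p p∈ _ _ _ _ _ = empty-bin p∈ refl refl
    ... | partners-packed done = partners-packed done
    ... | bin-holds-only-p _ _ _ L≡ap = partners-packed λ w (_ , ap+aw≤1) w∈ →
          y-overflows (ℚₚ.≤-trans (ℚₚ.+-mono-≤ (ℚₚ.≤-reflexive L≡ap) (sorted w y (≤y w∈))) ap+aw≤1)

  run-paired : ∀ fuel rem bin cnt L acc → Invariant rem bin cnt L acc
             → Sole (MMloop fuel a (2 ℕ.+ k) rem bin cnt L acc) p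
             → PartnersPaired (MMloop fuel a (2 ℕ.+ k) rem bin cnt L acc)
  run-paired ℕ.zero     rem      bin cnt L acc inv _ = invariant⇒paired inv
  run-paired (suc fuel) []       bin cnt L acc inv _ = invariant⇒paired inv
  run-paired (suc fuel) (x ∷ xs) bin cnt L acc inv sole with cnt ℕ.≟ 2 ℕ.+ k
  ... | yes refl = run-paired fuel (x ∷ xs) (suc bin) 0 0ℚ acc (close-full inv) sole
  ... | no _ with (L ℚ.+ a x) ℚₚ.≤? 1ℚ
  ...   | yes fits = run-paired fuel xs bin (suc cnt) (L ℚ.+ a x) (update acc x bin)
          (pack-head inv fits (sole⇒soleAmongPacked fuel a (2 ℕ.+ k) xs bin (suc cnt) _ _ sole))
          sole
  ...   | no x-overflows with unsnoc (x ∷ xs) in eq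
  ...     | nothing = invariant⇒paired inv
  ...     | just (ys , y) with (L ℚ.+ a y) ℚₚ.≤? 1ℚ
  ...       | yes fits = run-paired fuel ys bin (suc cnt) (L ℚ.+ a y) (update acc y bin)
              (pack-tail inv x-overflows fits (removal-last (unsnoc≡just⇒∷ʳ eq) (increasing inv))
                 (sole⇒soleAmongPacked fuel a (2 ℕ.+ k) ys bin (suc cnt) _ _ sole))
              sole
  ...       | no y-overflows = run-paired fuel (x ∷ xs) (suc bin) 0 0ℚ acc
              (close-stuck inv (last-≥ (unsnoc≡just⇒∷ʳ eq) (increasing inv)) y-overflows) sole

  initial : Invariant (allFin (suc n)) 0 0 0ℚ (λ _ → 0)
  initial = record
    { increasing      = AllPairsₚ.tabulate⁺-< (λ i<j → i<j)
    ; unpacked-in-0   = λ _ → refl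
    ; zero-in-0       = refl
    ; zero-first      = λ _ → refl , refl , refl
    ; packed-partners = λ w _ w∉ → ⊥-elim (w∉ (∈-allFin w))
    ; phase           = empty-bin (∈-allFin p) refl refl
    }

  MM-partners-paired : Sole (MM (2 ℕ.+ k) a) p → PartnersPaired (MM (2 ℕ.+ k) a)
  MM-partners-paired = run-paired (3 * suc n ℕ.+ 1) (allFin (suc n)) 0 0 0ℚ (λ _ → 0) initial

lemma1 : ∀ (n : ℕ) (a : Items n) → InUnitInterval a → Sorted a
       → (p : Fin n) → IsMaxSoleClass1 a (MM₂ a) p
       → (g : Fin n → ℕ) → IsAssignment a g
       → ∀ w → InW g p w → InU (MM₂ a) p w
lemma1 ℕ.zero    _ _     _      ()
lemma1 (suc n) a sizes sorted p ((p-sole , p-class1) , _) g g-fits w (i , i≤p , w≢i , gw≡gi) =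
  proj₁ w-partner , MM-partners-paired p-sole w w-partner
  where
  open Partners a sizes sorted 0 p p-class1
  w-partner : Partner w
  w-partner = co-packed⇒partner g-fits i≤p w≢i gw≡gi
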